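{- Let $G=(V,E)$ be a finite simple graph with $|V|=n$ and $|E|=m$, and let $d_u$ be the degree of $u$ in $G$. For every integer $k\geq 2$, $$SO(G^{\frac{1}{k}}) = 2m(k-2)\sqrt{2}+ \sum_{u\in V}d_u\sqrt{d_u^2+4},$$ where $SO(H)=\sum_{xy\in E(H)}\sqrt{d_x(H)^2+d_y(H)^2}$ is the Sombor index.
   Context: For $k\in\mathbb{N}$, the $k$-subdivision $G^{\frac1k}$ of $G$ is the simple graph obtained by replacing each edge of $G$ with a path of length $k$ (with $k-1$ new internal vertices per edge). -}

module Defs where

open import Level using (Level; _⊔_) renaming (suc to lsuc)
open import Data.Nat as ℕ using (ℕ; zero; suc)
open import Data.Fin as Fin using (Fin; zero; suc; inject₁; fromℕ)
open import Data.Fin.Properties using () renaming (_≟_ to _≟F_)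
open import Data.List using (List; []; _∷_; _++_; map; zip; allFin; length; concat)
open import Data.List.Relation.Unary.All using (All)
open import Data.List.Relation.Unary.Unique.Propositional using (Unique)
open import Data.Product using (_×_; _,_; proj₁; proj₂)
open import Data.Sum using (_⊎_; inj₁; inj₂)
open import Data.Sum.Properties using (≡-dec)
open import Data.Product.Properties using () renaming (≡-dec to ≡-dec×)
open import Data.Bool using (if_then_else_)
open import Relation.Nullary.Decidable using (⌊_⌋)
open import Relation.Binary.Definitions using (DecidableEquality)
open import Algebra.Bundles using (CommutativeRing)

-- Finite simple graphs on the vertex set Fin n.
-- The edge set is a duplicate-free list of pairs (i , j) with i < j,
-- so each unordered edge {i,j} (i ≠ j) occurs exactly once.

record SimpleGraph (n : ℕ) : Set where
  field
    edges    : List (Fin n × Fin n)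
    ordered  : All (λ e → proj₁ e Fin.< proj₂ e) edges
    distinct : Unique edges

open SimpleGraph public

numEdges : ∀ {n} → SimpleGraph n → ℕ
numEdges G = length (edges G)

deg : ∀ {V : Set} → DecidableEquality V → List (V × V) → V → ℕ
deg _≟_ [] v = 0
deg _≟_ ((a , b) ∷ es) v =
  (if ⌊ a ≟ v ⌋ then 1 else 0) ℕ.+ (if ⌊ b ≟ v ⌋ then 1 else 0) ℕ.+ deg _≟_ es v

degree : ∀ {n} → SimpleGraph n → Fin n → ℕ
degree G = deg _≟F_ (edges G)

-- Vertices: original vertices (inj₁ u) plus, for the
-- i-th edge, the k-1 internal vertices inj₂ (i , t), t : Fin (k ∸ 1).
-- The i-th edge (u , v) becomes the path
--   u , (i,0) , (i,1) , … , (i,k-2) , v   (length k).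

SubV : ℕ → ℕ → ℕ → Set
SubV n m k = Fin n ⊎ (Fin m × Fin (k ℕ.∸ 1))

SubV-dec : ∀ n m k → DecidableEquality (SubV n m k)
SubV-dec n m k = ≡-dec _≟F_ (≡-dec× _≟F_ _≟F_)

pathEdges : ∀ {n m} k → Fin m → Fin n × Fin n → List (SubV n m k × SubV n m k)
pathEdges zero i (u , v) = []     -- k = 0 is not meaningful; never used
pathEdges (suc zero) i (u , v) = (inj₁ u , inj₁ v) ∷ []
pathEdges (suc (suc j)) i (u , v) =
  (inj₁ u , inj₂ (i , zero))
  ∷ (map (λ t → (inj₂ (i , inject₁ t) , inj₂ (i , suc t))) (allFin j)
     ++ ((inj₂ (i , fromℕ j) , inj₁ v) ∷ []))

subdivEdges : ∀ {n} (G : SimpleGraph n) (k : ℕ) →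
              List (SubV n (numEdges G) k × SubV n (numEdges G) k)
subdivEdges G k =
  concat (map (λ p → pathEdges k (proj₁ p) (proj₂ p))
              (zip (allFin (numEdges G)) (edges G)))

-- Real-number substitute: a commutative ring equipped with a square-root
-- function on naturals satisfying the laws of the real square root on ℕ.

module _ {c ℓ : Level} (R : CommutativeRing c ℓ) where
  open CommutativeRing R

  ι : ℕ → Carrier
  ι zero    = 0#
  ι (suc n) = 1# + ι n

  Σ : List Carrier → Carrier
  Σ []       = 0#
  Σ (x ∷ xs) = x + Σ xs

record SqrtRing (c ℓ : Level) : Set (lsuc (c ⊔ ℓ)) where
  field
    cring : CommutativeRing c ℓ
  open CommutativeRing cring
  field
    √    : ℕ → Carrier
    √-*  : ∀ a b → √ (a ℕ.* b) ≈ √ a * √ b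
    √-sq : ∀ a → √ (a ℕ.* a) ≈ ι cring a

SO : ∀ {c ℓ} (S : SqrtRing c ℓ) {V : Set} → DecidableEquality V →
     List (V × V) → CommutativeRing.Carrier (SqrtRing.cring S)
SO S _≟_ es =
  Σ (SqrtRing.cring S)
    (map (λ e → SqrtRing.√ S (d (proj₁ e) ℕ.* d (proj₁ e) ℕ.+ d (proj₂ e) ℕ.* d (proj₂ e))) es)
  where d = deg _≟_ es

-- Subdividing G keeps the degree d_u of every original vertex u and gives every new vertex degree 2.
-- Hence the edge uv of G becomes a path whose two end edges have Sombor weights √(d_u² + 4) and
-- √(d_v² + 4) and whose k − 2 inner edges have weight √(2² + 2²) = 2√2.  Summed over all edges, the
-- end weight √(d_u² + 4) occurs once for each edge at u, that is d_u times (handshake lemma).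

module Submission where

open import Defs
open import Data.Nat as ℕ using (ℕ; _≤_; _∸_) renaming (_*_ to _*ℕ_; _+_ to _+ℕ_)
open import Data.List using (map; allFin)
open import Algebra.Bundles using (CommutativeRing)
open import Data.Product using (proj₂)
open import Relation.Binary.PropositionalEquality using (cong)
import Relation.Binary.Reasoning.Setoid as SetoidReasoning

module Degrees where

  open import Data.Nat using (zero; suc; _+_; _*_)
  open import Data.Nat.Properties using (+-identityʳ; +-assoc; *-distribˡ-+; +-commutativeSemigroup) renaming (suc-injective to suc-injectiveℕ)
  open import Data.Nat.Tactic.RingSolver using (solve-∀)
  open import Algebra.Properties.CommutativeSemigroup +-commutativeSemigroup using (interchange)
  open import Data.Fin using (Fin; zero; suc; inject₁; fromℕ)
  open import Data.Fin.Properties using (0≢1+n; suc-injective) renaming (_≟_ to _≟F_)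
  open import Data.List using (List; []; _∷_; _++_; _∷ʳ_; zip; tabulate; concat; length)
  open import Data.List.Properties using (map-tabulate; length-tabulate)
  open import Data.Product using (_×_; _,_; proj₁; proj₂)
  open import Data.Sum using (inj₁; inj₂)
  open import Data.Bool using (if_then_else_)
  open import Relation.Nullary.Decidable using (Dec; yes; no; ⌊_⌋; isYes≗does; dec-true; dec-false; ⌊⌋-map′)
  open import Relation.Binary.Definitions using (DecidableEquality)
  open import Relation.Binary.PropositionalEquality
  open import Function using (_∘_; id)
  open import Function.Definitions using (Injective)

  module _ {V : Set} (_≟_ : DecidableEquality V) where

    δ : V → V → ℕ
    δ a v = if ⌊ a ≟ v ⌋ then 1 else 0

    δ-refl : ∀ a → δ a a ≡ 1
    δ-refl a = cong (λ b → if b then 1 else 0) (trans (isYes≗does (a ≟ a)) (dec-true (a ≟ a) refl))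

    δ-≢ : ∀ {a v} → a ≢ v → δ a v ≡ 0
    δ-≢ {a} {v} a≢v = cong (λ b → if b then 1 else 0) (trans (isYes≗does (a ≟ v)) (dec-false (a ≟ v) a≢v))

    count : List V → V → ℕ
    count []       v = 0
    count (a ∷ as) v = δ a v + count as v

    count-++ : ∀ xs ys v → count (xs ++ ys) v ≡ count xs v + count ys v
    count-++ []       ys v = refl
    count-++ (x ∷ xs) ys v = trans (cong (δ x v +_) (count-++ xs ys v)) (sym (+-assoc (δ x v) _ _))

    count-tabulate-≢ : ∀ {n} (g : Fin n → V) {v} → (∀ s → g s ≢ v) → count (tabulate g) v ≡ 0
    count-tabulate-≢ {zero}  g g≢v = refl
    count-tabulate-≢ {suc n} g g≢v = cong₂ _+_ (δ-≢ (g≢v zero)) (count-tabulate-≢ (g ∘ suc) (g≢v ∘ suc))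

    count-tabulate-injective : ∀ {n} (g : Fin n → V) → Injective _≡_ _≡_ g → ∀ t → count (tabulate g) (g t) ≡ 1
    count-tabulate-injective {suc n} g g-inj zero =
      cong₂ _+_ (δ-refl (g zero)) (count-tabulate-≢ (g ∘ suc) (λ s e → 0≢1+n (g-inj (sym e))))
    count-tabulate-injective {suc n} g g-inj (suc t) =
      cong₂ _+_ (δ-≢ (0≢1+n ∘ g-inj)) (count-tabulate-injective (g ∘ suc) (suc-injective ∘ g-inj) t)

    deg-++ : ∀ xs ys v → deg _≟_ (xs ++ ys) v ≡ deg _≟_ xs v + deg _≟_ ys v
    deg-++ []             ys v = refl
    deg-++ ((a , b) ∷ xs) ys v = trans (cong (δ a v + δ b v +_) (deg-++ xs ys v)) (sym (+-assoc (δ a v + δ b v) _ _))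

    deg-tabulate : ∀ {n} (p q : Fin n → V) v →
      deg _≟_ (tabulate (λ t → p t , q t)) v ≡ count (tabulate p) v + count (tabulate q) v
    deg-tabulate {zero}  p q v = refl
    deg-tabulate {suc n} p q v =
      trans (cong (δ (p zero) v + δ (q zero) v +_) (deg-tabulate (p ∘ suc) (q ∘ suc) v))
            (interchange (δ (p zero) v) (δ (q zero) v) _ _)

  tabulate-∷ʳ : ∀ {A : Set} {j} (g : Fin (suc j) → A) → tabulate g ≡ tabulate (g ∘ inject₁) ∷ʳ g (fromℕ j)
  tabulate-∷ʳ {j = zero}  g = refl
  tabulate-∷ʳ {j = suc j} g = cong (g zero ∷_) (tabulate-∷ʳ (g ∘ suc))

  map-proj₁-zip : ∀ {A B : Set} (xs : List A) (ys : List B) → length xs ≡ length ys → map proj₁ (zip xs ys) ≡ xs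
  map-proj₁-zip []       []       _ = refl
  map-proj₁-zip (x ∷ xs) (y ∷ ys) e = cong (x ∷_) (map-proj₁-zip xs ys (suc-injectiveℕ e))

  map-proj₂-zip : ∀ {A B : Set} (xs : List A) (ys : List B) → length xs ≡ length ys → map proj₂ (zip xs ys) ≡ ys
  map-proj₂-zip []       []       _ = refl
  map-proj₂-zip (x ∷ xs) (y ∷ ys) e = cong (y ∷_) (map-proj₂-zip xs ys (suc-injectiveℕ e))

  module SubdivisionDegrees (n m j : ℕ) where

    V : Set
    V = SubV n m (suc (suc j))

    _≟V_ : DecidableEquality V
    _≟V_ = SubV-dec n m (suc (suc j))

    δV : V → V → ℕ
    δV = δ _≟V_

    countV : List V → V → ℕ
    countV = count _≟V_

    interior : Fin m → Fin (suc j) → V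
    interior x t = inj₂ (x , t)

    path : Fin m → Fin n × Fin n → List (V × V)
    path = pathEdges (suc (suc j))

    paths : List (Fin m × (Fin n × Fin n)) → List (V × V)
    paths ps = concat (map (λ p → path (proj₁ p) (proj₂ p)) ps)

    deg-path : ∀ x a b w →
      deg _≟V_ (path x (a , b)) w ≡ δV (inj₁ a) w + δV (inj₁ b) w + 2 * countV (tabulate (interior x)) w
    deg-path x a b w = begin
        deg _≟V_ (path x (a , b)) w
      ≡⟨⟩
        δA + δV (g zero) w + deg _≟V_ (middle ++ (g (fromℕ j) , inj₁ b) ∷ []) w
      ≡⟨ cong (δA + δV (g zero) w +_) (deg-++ _≟V_ middle _ w) ⟩
        δA + δV (g zero) w + (deg _≟V_ middle w + (δV (g (fromℕ j)) w + δB + 0))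
      ≡⟨ cong (λ z → δA + δV (g zero) w + (z + (δV (g (fromℕ j)) w + δB + 0))) deg-middle ⟩
        δA + δV (g zero) w + (countV (tabulate (g ∘ inject₁)) w + countV (tabulate (g ∘ suc)) w + (δV (g (fromℕ j)) w + δB + 0))
      ≡⟨ regroup δA δB (δV (g zero) w) (countV (tabulate (g ∘ suc)) w) (countV (tabulate (g ∘ inject₁)) w) (δV (g (fromℕ j)) w) ⟩
        δA + δB + (countV (tabulate g) w + (countV (tabulate (g ∘ inject₁)) w + (δV (g (fromℕ j)) w + 0) + 0))
      ≡⟨ cong (λ c → δA + δB + (countV (tabulate g) w + (c + 0))) (sym count-by-last) ⟩
        δA + δB + 2 * countV (tabulate g) w ∎
      where
      -- The tails g zero, g (suc t) and the heads g (inject₁ t), g (fromℕ j) of the edges each list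
      -- the interior vertices exactly once.
      open ≡-Reasoning
      g : Fin (suc j) → V
      g = interior x
      δA δB : ℕ
      δA = δV (inj₁ a) w
      δB = δV (inj₁ b) w
      middle : List (V × V)
      middle = map (λ t → g (inject₁ t) , g (suc t)) (allFin j)
      deg-middle : deg _≟V_ middle w ≡ countV (tabulate (g ∘ inject₁)) w + countV (tabulate (g ∘ suc)) w
      deg-middle = trans (cong (λ es → deg _≟V_ es w) (map-tabulate {n = j} id (λ t → g (inject₁ t) , g (suc t)))) (deg-tabulate _≟V_ (g ∘ inject₁) (g ∘ suc) w)
      count-by-last : countV (tabulate g) w ≡ countV (tabulate (g ∘ inject₁)) w + (δV (g (fromℕ j)) w + 0)
      count-by-last = trans (cong (λ xs → countV xs w) (tabulate-∷ʳ g)) (count-++ _≟V_ (tabulate (g ∘ inject₁)) _ w)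
      regroup : ∀ a b z s i f → a + z + (i + s + (f + b + 0)) ≡ a + b + (z + s + ((i + (f + 0)) + 0))
      regroup = solve-∀

    δV-inj₁ : ∀ a u → δV (inj₁ a) (inj₁ u) ≡ δ _≟F_ a u
    δV-inj₁ a u = cong (λ b → if b then 1 else 0) (⌊⌋-map′ _ _ (a ≟F u))

    interior-injective : ∀ {x} → Injective _≡_ _≡_ (interior x)
    interior-injective refl = refl

    count-interior : ∀ x i t → countV (tabulate (interior x)) (interior i t) ≡ δ _≟F_ x i
    count-interior x i t = by-cases (x ≟F i)
      where
      by-cases : Dec (x ≡ i) → countV (tabulate (interior x)) (interior i t) ≡ δ _≟F_ x i
      by-cases (yes refl) = trans (count-tabulate-injective _≟V_ (interior x) interior-injective t) (sym (δ-refl _≟F_ x))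
      by-cases (no x≢i)   = trans (count-tabulate-≢ _≟V_ (interior x) (λ { s refl → x≢i refl })) (sym (δ-≢ _≟F_ x≢i))

    deg-path-original : ∀ x a b u → deg _≟V_ (path x (a , b)) (inj₁ u) ≡ δ _≟F_ a u + δ _≟F_ b u
    deg-path-original x a b u = begin
        deg _≟V_ (path x (a , b)) (inj₁ u)
      ≡⟨ deg-path x a b (inj₁ u) ⟩
        δV (inj₁ a) (inj₁ u) + δV (inj₁ b) (inj₁ u) + 2 * countV (tabulate (interior x)) (inj₁ u)
      ≡⟨ cong₂ _+_ (cong₂ _+_ (δV-inj₁ a u) (δV-inj₁ b u)) (cong (2 *_) (count-tabulate-≢ _≟V_ (interior x) {inj₁ u} (λ _ ()))) ⟩
        δ _≟F_ a u + δ _≟F_ b u + 0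
      ≡⟨ +-identityʳ _ ⟩
        δ _≟F_ a u + δ _≟F_ b u ∎
      where open ≡-Reasoning

    deg-path-interior : ∀ x a b i t → deg _≟V_ (path x (a , b)) (interior i t) ≡ 2 * δ _≟F_ x i
    deg-path-interior x a b i t = trans (deg-path x a b (interior i t)) (cong (2 *_) (count-interior x i t))

    deg-paths-original : ∀ ps u → deg _≟V_ (paths ps) (inj₁ u) ≡ deg _≟F_ (map proj₂ ps) u
    deg-paths-original []                   u = refl
    deg-paths-original ((x , (a , b)) ∷ ps) u =
      trans (deg-++ _≟V_ (path x (a , b)) (paths ps) (inj₁ u))
            (cong₂ _+_ (deg-path-original x a b u) (deg-paths-original ps u))

    deg-paths-interior : ∀ ps i t → deg _≟V_ (paths ps) (interior i t) ≡ 2 * count _≟F_ (map proj₁ ps) i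
    deg-paths-interior []                   i t = refl
    deg-paths-interior ((x , (a , b)) ∷ ps) i t =
      trans (deg-++ _≟V_ (path x (a , b)) (paths ps) (interior i t))
            (trans (cong₂ _+_ (deg-path-interior x a b i t) (deg-paths-interior ps i t))
                   (sym (*-distribˡ-+ 2 (δ _≟F_ x i) _)))

  module _ {n} (G : SimpleGraph n) where

    indexedEdges : List (Fin (numEdges G) × (Fin n × Fin n))
    indexedEdges = zip (allFin (numEdges G)) (edges G)

    map-proj₁-indexedEdges : map proj₁ indexedEdges ≡ allFin (numEdges G)
    map-proj₁-indexedEdges = map-proj₁-zip (allFin (numEdges G)) (edges G) (length-tabulate id)

    map-proj₂-indexedEdges : map proj₂ indexedEdges ≡ edges G
    map-proj₂-indexedEdges = map-proj₂-zip (allFin (numEdges G)) (edges G) (length-tabulate id)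

    module _ (j : ℕ) where
      open SubdivisionDegrees n (numEdges G) j

      degree-subdivision-original : ∀ u → deg _≟V_ (subdivEdges G (suc (suc j))) (inj₁ u) ≡ degree G u
      degree-subdivision-original u =
        trans (deg-paths-original indexedEdges u) (cong (λ es → deg _≟F_ es u) map-proj₂-indexedEdges)

      degree-subdivision-interior : ∀ i t → deg _≟V_ (subdivEdges G (suc (suc j))) (interior i t) ≡ 2
      degree-subdivision-interior i t = begin
          deg _≟V_ (paths indexedEdges) (interior i t)
        ≡⟨ deg-paths-interior indexedEdges i t ⟩
          2 * count _≟F_ (map proj₁ indexedEdges) i
        ≡⟨ cong (λ xs → 2 * count _≟F_ xs i) map-proj₁-indexedEdges ⟩
          2 * count _≟F_ (allFin (numEdges G)) i
        ≡⟨ cong (2 *_) (count-tabulate-injective _≟F_ id id i) ⟩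
          2 ∎
        where open ≡-Reasoning

open Degrees

module Sums {c ℓ} (S : SqrtRing c ℓ) where

  open import Data.Nat using (zero; suc)
  open import Data.Nat.Tactic.RingSolver using (solve-∀)
  open import Data.Fin as Fin using (Fin; inject₁; fromℕ)
  open import Data.Fin.Properties using () renaming (_≟_ to _≟F_)
  import Data.Nat.Properties as ℕₚ
  open import Data.Sum using (inj₁; inj₂)
  open import Data.List using (List; []; _∷_; _++_; concat; length)
  open import Data.List.Properties using (map-++; map-∘; length-tabulate)
  open import Data.Product using (_×_; _,_; proj₁; proj₂)
  open import Relation.Nullary.Decidable using (Dec; yes; no)
  open import Relation.Binary.Definitions using (DecidableEquality)
  open import Relation.Binary.PropositionalEquality as ≡ using (_≡_; _≢_)
  open import Function using (_∘_; id)
  open SqrtRing S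
  open CommutativeRing cring
  open import Algebra.Properties.Semiring.Mult semiring using (×-homo-+; ×1-homo-*) renaming (_×_ to _·_)
  open import Algebra.Properties.CommutativeSemigroup +-commutativeSemigroup using (interchange)
  open import Relation.Binary.Reasoning.Setoid setoid

  ιR : ℕ → Carrier
  ιR = ι cring

  ΣR : List Carrier → Carrier
  ΣR = Σ cring

  ι≡·1# : ∀ a → ιR a ≡ a · 1#
  ι≡·1# zero    = ≡.refl
  ι≡·1# (suc a) = ≡.cong (1# +_) (ι≡·1# a)

  ι-+ : ∀ a b → ιR (a +ℕ b) ≈ ιR a + ιR b
  ι-+ a b rewrite ι≡·1# (a +ℕ b) | ι≡·1# a | ι≡·1# b = ×-homo-+ 1# a b

  ι-* : ∀ a b → ιR (a *ℕ b) ≈ ιR a * ιR b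
  ι-* a b rewrite ι≡·1# (a *ℕ b) | ι≡·1# a | ι≡·1# b = ×1-homo-* a b

  ι-+-distribʳ : ∀ a b x → ιR (a +ℕ b) * x ≈ ιR a * x + ιR b * x
  ι-+-distribʳ a b x = trans (*-congʳ (ι-+ a b)) (distribʳ x (ιR a) (ιR b))

  Σ-++ : ∀ xs ys → ΣR (xs ++ ys) ≈ ΣR xs + ΣR ys
  Σ-++ []       ys = sym (+-identityˡ _)
  Σ-++ (x ∷ xs) ys = trans (+-congˡ (Σ-++ xs ys)) (sym (+-assoc x _ _))

  Σ-cong : ∀ {A : Set} {g h : A → Carrier} xs → (∀ x → g x ≈ h x) → ΣR (map g xs) ≈ ΣR (map h xs)
  Σ-cong []       g≈h = refl
  Σ-cong (x ∷ xs) g≈h = +-cong (g≈h x) (Σ-cong xs g≈h)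

  Σ-+ : ∀ {A : Set} (g h : A → Carrier) xs → ΣR (map (λ x → g x + h x) xs) ≈ ΣR (map g xs) + ΣR (map h xs)
  Σ-+ g h []       = sym (+-identityˡ _)
  Σ-+ g h (x ∷ xs) = trans (+-congˡ (Σ-+ g h xs)) (interchange (g x) (h x) _ _)

  Σ-const : ∀ {A : Set} {g : A → Carrier} {y} xs → (∀ x → g x ≈ y) → ΣR (map g xs) ≈ ιR (length xs) * y
  Σ-const []       g≈y = sym (zeroˡ _)
  Σ-const (x ∷ xs) g≈y = trans (+-cong (trans (g≈y x) (sym (*-identityˡ _))) (Σ-const xs g≈y)) (sym (distribʳ _ 1# _))

  Σ-concatMap : ∀ {A B : Set} (g : B → Carrier) (P : A → List B) xs →
    ΣR (map g (concat (map P xs))) ≈ ΣR (map (λ x → ΣR (map g (P x))) xs)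
  Σ-concatMap g P []       = refl
  Σ-concatMap g P (x ∷ xs) = begin
      ΣR (map g (P x ++ concat (map P xs)))
    ≡⟨ ≡.cong ΣR (map-++ g (P x) _) ⟩
      ΣR (map g (P x) ++ map g (concat (map P xs)))
    ≈⟨ Σ-++ (map g (P x)) _ ⟩
      ΣR (map g (P x)) + ΣR (map g (concat (map P xs)))
    ≈⟨ +-congˡ (Σ-concatMap g P xs) ⟩
      ΣR (map g (P x)) + ΣR (map (λ x → ΣR (map g (P x))) xs) ∎

  module _ {V : Set} (_≟_ : DecidableEquality V) (g : V → Carrier) where

    ι-δ-≢ : ∀ {a v} y → a ≢ v → ιR (δ _≟_ a v) * y ≈ 0#
    ι-δ-≢ y a≢v = trans (*-congʳ (reflexive (≡.cong ιR (δ-≢ _≟_ a≢v)))) (zeroˡ y)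

    ι-δ-swap : ∀ a x → ιR (δ _≟_ a x) * g x ≈ ιR (δ _≟_ x a) * g a
    ι-δ-swap a x = by-cases (a ≟ x)
      where
      by-cases : Dec (a ≡ x) → ιR (δ _≟_ a x) * g x ≈ ιR (δ _≟_ x a) * g a
      by-cases (yes ≡.refl) = refl
      by-cases (no a≢x)     = trans (ι-δ-≢ (g x) a≢x) (sym (ι-δ-≢ (g a) (a≢x ∘ ≡.sym)))

    Σ-δ : ∀ a xs → ΣR (map (λ u → ιR (δ _≟_ a u) * g u) xs) ≈ ιR (count _≟_ xs a) * g a
    Σ-δ a []       = sym (zeroˡ _)
    Σ-δ a (x ∷ xs) = begin
        ιR (δ _≟_ a x) * g x + ΣR (map (λ u → ιR (δ _≟_ a u) * g u) xs)
      ≈⟨ +-cong (ι-δ-swap a x) (Σ-δ a xs) ⟩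
        ιR (δ _≟_ x a) * g a + ιR (count _≟_ xs a) * g a
      ≈⟨ sym (ι-+-distribʳ (δ _≟_ x a) _ (g a)) ⟩
        ιR (count _≟_ (x ∷ xs) a) * g a ∎

  Σ-δ-allFin : ∀ {n} (g : Fin n → Carrier) a → ΣR (map (λ u → ιR (δ _≟F_ a u) * g u) (allFin n)) ≈ g a
  Σ-δ-allFin {n} g a = begin
      ΣR (map (λ u → ιR (δ _≟F_ a u) * g u) (allFin n))
    ≈⟨ Σ-δ _≟F_ g a (allFin n) ⟩
      ιR (count _≟F_ (allFin n) a) * g a
    ≡⟨ ≡.cong (λ k → ιR k * g a) (count-tabulate-injective _≟F_ id id a) ⟩
      (1# + 0#) * g a
    ≈⟨ trans (*-congʳ (+-identityʳ 1#)) (*-identityˡ (g a)) ⟩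
      g a ∎

  handshake : ∀ {n} (f : Fin n → Carrier) es →
    ΣR (map (λ e → f (proj₁ e) + f (proj₂ e)) es) ≈ ΣR (map (λ u → ιR (deg _≟F_ es u) * f u) (allFin n))
  handshake {n} f [] = sym (trans (Σ-const (allFin n) (λ u → zeroˡ (f u))) (zeroʳ _))
  handshake {n} f ((a , b) ∷ es) = begin
      f a + f b + ΣR (map (λ e → f (proj₁ e) + f (proj₂ e)) es)
    ≈⟨ +-cong (+-cong (sym (Σ-δ-allFin f a)) (sym (Σ-δ-allFin f b))) (handshake f es) ⟩
      ΣR (map weightA (allFin n)) + ΣR (map weightB (allFin n)) + ΣR (map weightRest (allFin n))
    ≈⟨ sym (trans (Σ-+ _ weightRest (allFin n)) (+-congʳ (Σ-+ weightA weightB (allFin n)))) ⟩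
      ΣR (map (λ u → weightA u + weightB u + weightRest u) (allFin n))
    ≈⟨ Σ-cong (allFin n) (λ u → sym (weight-split u)) ⟩
      ΣR (map (λ u → ιR (deg _≟F_ ((a , b) ∷ es) u) * f u) (allFin n)) ∎
    where
    weightA weightB weightRest : Fin n → Carrier
    weightA    u = ιR (δ _≟F_ a u) * f u
    weightB    u = ιR (δ _≟F_ b u) * f u
    weightRest u = ιR (deg _≟F_ es u) * f u
    weight-split : ∀ u → ιR (deg _≟F_ ((a , b) ∷ es) u) * f u ≈ weightA u + weightB u + weightRest u
    weight-split u = trans (ι-+-distribʳ (δ _≟F_ a u +ℕ δ _≟F_ b u) _ (f u)) (+-congʳ (ι-+-distribʳ (δ _≟F_ a u) _ (f u)))

  √8≈2√2 : √ 8 ≈ ιR 2 * √ 2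
  √8≈2√2 = trans (√-* 4 2) (*-congʳ (√-sq 2))

  middle-weight : ∀ m j → ιR m * (ιR j * √ 8) ≈ ιR (2 *ℕ m *ℕ j) * √ 2
  middle-weight m j = begin
      ιR m * (ιR j * √ 8)
    ≈⟨ *-congˡ (*-congˡ √8≈2√2) ⟩
      ιR m * (ιR j * (ιR 2 * √ 2))
    ≈⟨ trans (*-congˡ (sym (*-assoc _ _ _))) (sym (*-assoc _ _ _)) ⟩
      ιR m * (ιR j * ιR 2) * √ 2
    ≈⟨ *-congʳ (sym (trans (ι-* m (j *ℕ 2)) (*-congˡ (ι-* j 2)))) ⟩
      ιR (m *ℕ (j *ℕ 2)) * √ 2
    ≡⟨ ≡.cong (λ k → ιR k * √ 2) (reorder m j) ⟩
      ιR (2 *ℕ m *ℕ j) * √ 2 ∎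
    where
    reorder : ∀ m j → m *ℕ (j *ℕ 2) ≡ 2 *ℕ m *ℕ j
    reorder = solve-∀

  module PathWeights {n m j : ℕ} (D : SubV n m (suc (suc j)) → ℕ) (d : Fin n → ℕ)
    (D-original : ∀ u → D (inj₁ u) ≡ d u) (D-interior : ∀ i t → D (inj₂ (i , t)) ≡ 2) where

    open SubdivisionDegrees n m j using (V; path; paths)

    edgeWeight : V × V → Carrier
    edgeWeight e = √ (D (proj₁ e) *ℕ D (proj₁ e) +ℕ D (proj₂ e) *ℕ D (proj₂ e))

    endWeight : Fin n → Carrier
    endWeight u = √ (d u *ℕ d u +ℕ 4)

    endsWeight : Fin n × Fin n → Carrier
    endsWeight e = endWeight (proj₁ e) + endWeight (proj₂ e)

    edgeWeight-≡ : ∀ {x y p q} → D x ≡ p → D y ≡ q → edgeWeight (x , y) ≡ √ (p *ℕ p +ℕ q *ℕ q)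
    edgeWeight-≡ Dx≡p Dy≡q = ≡.cong √ (≡.cong₂ (λ p q → p *ℕ p +ℕ q *ℕ q) Dx≡p Dy≡q)

    Σ-edgeWeight-path : ∀ x a b → ΣR (map edgeWeight (path x (a , b))) ≈ endsWeight (a , b) + ιR j * √ 8
    Σ-edgeWeight-path x a b = begin
        ΣR (map edgeWeight (path x (a , b)))
      ≡⟨⟩
        edgeWeight first + ΣR (map edgeWeight (middle ++ last ∷ []))
      ≈⟨ +-congˡ (trans (reflexive (≡.cong ΣR (map-++ edgeWeight middle _))) (Σ-++ (map edgeWeight middle) _)) ⟩
        edgeWeight first + (ΣR (map edgeWeight middle) + (edgeWeight last + 0#))
      ≈⟨ +-cong (reflexive first-weight) (+-cong middle-weights (trans (+-identityʳ _) (reflexive last-weight))) ⟩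
        endWeight a + (ιR j * √ 8 + endWeight b)
      ≈⟨ trans (+-congˡ (+-comm _ _)) (sym (+-assoc _ _ _)) ⟩
        endsWeight (a , b) + ιR j * √ 8 ∎
      where
      first last : V × V
      first = inj₁ a , inj₂ (x , Fin.zero)
      last  = inj₂ (x , fromℕ j) , inj₁ b
      middle : List (V × V)
      middle = map (λ t → inj₂ (x , inject₁ t) , inj₂ (x , Fin.suc t)) (allFin j)
      first-weight : edgeWeight first ≡ endWeight a
      first-weight = edgeWeight-≡ (D-original a) (D-interior x Fin.zero)
      last-weight : edgeWeight last ≡ endWeight b
      last-weight = ≡.trans (edgeWeight-≡ (D-interior x (fromℕ j)) (D-original b)) (≡.cong √ (ℕₚ.+-comm 4 (d b *ℕ d b)))
      middle-weights : ΣR (map edgeWeight middle) ≈ ιR j * √ 8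
      middle-weights = begin
          ΣR (map edgeWeight middle)
        ≡⟨ ≡.cong ΣR (≡.sym (map-∘ (allFin j))) ⟩
          ΣR (map (λ t → edgeWeight (inj₂ (x , inject₁ t) , inj₂ (x , Fin.suc t))) (allFin j))
        ≈⟨ Σ-const (allFin j) (λ t → reflexive (edgeWeight-≡ (D-interior x (inject₁ t)) (D-interior x (Fin.suc t)))) ⟩
          ιR (length (allFin j)) * √ 8
        ≡⟨ ≡.cong (λ k → ιR k * √ 8) (length-tabulate {n = j} id) ⟩
          ιR j * √ 8 ∎

    Σ-edgeWeight-paths : ∀ ps → ΣR (map edgeWeight (paths ps))
      ≈ ΣR (map (λ e → endsWeight e + ιR j * √ 8) (map proj₂ ps))
    Σ-edgeWeight-paths ps = begin
        ΣR (map edgeWeight (paths ps))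
      ≈⟨ Σ-concatMap edgeWeight (λ p → path (proj₁ p) (proj₂ p)) ps ⟩
        ΣR (map (λ p → ΣR (map edgeWeight (path (proj₁ p) (proj₂ p)))) ps)
      ≈⟨ Σ-cong ps (λ p → Σ-edgeWeight-path (proj₁ p) (proj₁ (proj₂ p)) (proj₂ (proj₂ p))) ⟩
        ΣR (map (λ p → endsWeight (proj₂ p) + ιR j * √ 8) ps)
      ≡⟨ ≡.cong ΣR (map-∘ ps) ⟩
        ΣR (map (λ e → endsWeight e + ιR j * √ 8) (map proj₂ ps)) ∎


theorem3p3 : ∀ {c ℓ} (S : SqrtRing c ℓ) (n : ℕ) (G : SimpleGraph n) (k : ℕ) → 2 ≤ k →
    let R = SqrtRing.cring S
        open CommutativeRing R
        √ = SqrtRing.√ S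
        m = numEdges G
        d = degree G
    in SO S (SubV-dec n m k) (subdivEdges G k)
       ≈ ι R (2 *ℕ m *ℕ (k ∸ 2)) * √ 2
         + Σ R (map (λ u → ι R (d u) * √ (d u *ℕ d u +ℕ 4)) (allFin n))
theorem3p3 S n G (ℕ.suc (ℕ.suc j)) (ℕ.s≤s (ℕ.s≤s ℕ.z≤n)) = begin
    ΣR (map edgeWeight (paths (indexedEdges G)))
  ≈⟨ Σ-edgeWeight-paths (indexedEdges G) ⟩
    ΣR (map (λ e → endsWeight e + ιR j * √ 8) (map proj₂ (indexedEdges G)))
  ≡⟨ cong (λ es → ΣR (map (λ e → endsWeight e + ιR j * √ 8) es)) (map-proj₂-indexedEdges G) ⟩
    ΣR (map (λ e → endsWeight e + ιR j * √ 8) (edges G))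
  ≈⟨ Σ-+ endsWeight (λ _ → ιR j * √ 8) (edges G) ⟩
    ΣR (map endsWeight (edges G)) + ΣR (map (λ _ → ιR j * √ 8) (edges G))
  ≈⟨ +-cong (handshake endWeight (edges G)) (Σ-const (edges G) (λ _ → refl)) ⟩
    ΣR (map (λ u → ιR (degree G u) * endWeight u) (allFin n)) + ιR (numEdges G) * (ιR j * √ 8)
  ≈⟨ trans (+-comm _ _) (+-congʳ (middle-weight (numEdges G) j)) ⟩
    ιR (2 *ℕ numEdges G *ℕ j) * √ 2 + ΣR (map (λ u → ιR (degree G u) * endWeight u) (allFin n)) ∎
  where
  open SqrtRing S
  open CommutativeRing cring
  open SetoidReasoning setoid
  open Sums S
  open SubdivisionDegrees n (numEdges G) j using (_≟V_; paths)
  open PathWeights (deg _≟V_ (subdivEdges G (ℕ.suc (ℕ.suc j)))) (degree G)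
                   (degree-subdivision-original G j) (degree-subdivision-interior G j)
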